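{- Let $\Gamma\subseteq\mathcal{L}'_{pqT}$ and let $\pi$ be a lex model with $\pi\models^*\Gamma$. Let $X\in V\setminus V_\pi$, let $\ge_X$ be a total order on $\underline{X}$, and let $\pi'=\pi\circ(X,\ge_X)$. Then $\pi'\models^*\Gamma$ if and only if $(X,\ge_X)$ is a valid extension of $\pi$ (with respect to $\Gamma$).
   Context: Let $V$ be a finite set of variables with finite nonempty domains $\underline{X}$; $\underline{A}=\prod_{X\in A}\underline{X}$; outcomes are elements of $\underline{V}$; $\alpha(U)$ is restriction. A lex model $\pi$ is a (possibly empty) sequence $(Y_1,\ge_{Y_1}),\ldots,(Y_k,\ge_{Y_k})$ of pairwise distinct variables each with a total order on its domain; $V_\pi=\{Y_1,\dots,Y_k\}$. $\alpha\succ_\pi\beta$ iff for some $i$, $\alpha(Y_j)=\beta(Y_j)$ for $j<i$ and $\alpha(Y_i)>_{Y_i}\beta(Y_i)$ strictly; $\alpha\equiv_\pi\beta$ iff $\alpha(V_\pi)=\beta(V_\pi)$; $\alpha\succcurlyeq_\pi\beta$ iff $\alpha\succ_\pi\beta$ or $\alpha\equiv_\pi\beta$. $\pi\circ(X,\ge_X)$ is the sequence $\pi$ with the pair $(X,\ge_X)$ appended (when $X\notin V_\pi$). $\pi'$ extends $\pi$ if $\pi'\ne\pi$ and $\pi'$ begins with $\pi$; $\pi'\sqsupseteq\pi$ means extends or equals; $\pi\models^*\psi$ iff some $\pi'\sqsupseteq\pi$ satisfies $\psi$, and $\pi\models^*\Gamma$ iff $\pi\models^*\psi$ for all $\psi\in\Gamma$.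 Language $\mathcal{L}_{pqT}$: a statement $\varphi$ consists of $\rhd\in\{\ge,\gg,>\}$, pairwise disjoint sets $U_\varphi,T_\varphi,R_\varphi\cup S_\varphi\subseteq V$, assignments $u_\varphi\in\underline{U_\varphi}$, $r_\varphi\in\underline{R_\varphi}$, $s_\varphi\in\underline{S_\varphi}$ with $r_\varphi(Y)\ne s_\varphi(Y)$ for $Y\in R_\varphi\cap S_\varphi$, every variable with a one-element domain lying in $T_\varphi$; written $u_\varphi r_\varphi\rhd u_\varphi s_\varphi\parallel T_\varphi$. $W_\varphi=V\setminus(R_\varphi\cup S_\varphi\cup T_\varphi\cup U_\varphi)$. $\varphi^*$ is the set of pairs $(\alpha,\beta)$ of outcomes with $\alpha$ extending $u_\varphi,r_\varphi$, $\beta$ extending $u_\varphi,s_\varphi$, and $\alpha(T_\varphi)=\beta(T_\varphi)$. Non-strict ($\ge$): $\pi\models\varphi$ iff $\alpha\succcurlyeq_\pi\beta$ for all $(\alpha,\beta)\in\varphi^*$; fully strict ($\gg$): iff $\alpha\succ_\pi\beta$ for all pairs; weakly strict ($>$): iff the non-strict version holds and $\alpha\succ_\pi\beta$ for some pair. $\mathcal{L}'_{pqT}=\mathcal{L}_{pqT}\cup\{\neg\varphi:\varphi\in\mathcal{L}_{pqT}\text{ non-strict},\ R_\varphi=S_\varphi\}$ with $\pi\models\neg\varphi$ iff $\pi\not\models\varphi$. For $\Gamma\subseteq\mathcal{L}'_{pqT}$, lex model $\pi$ and $X\in V$: let $\overline{\Gamma}=\{\varphi\in\Gamma\cap\mathcal{L}_{pqT}:R_\varphi\cap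 S_\varphi\cap V_\pi=\emptyset\}$; $\mathrm{Best}(X)=\{r_\varphi(X):\varphi\in\overline{\Gamma},X\in R_\varphi\setminus S_\varphi\}$; $\mathrm{Worst}(X)=\{s_\varphi(X):\varphi\in\overline{\Gamma},X\in S_\varphi\setminus R_\varphi\}$; $\mathrm{Pos}(X)=\{(r_\varphi(X),s_\varphi(X)):\varphi\in\overline{\Gamma},X\in R_\varphi\cap S_\varphi\}$; $\mathrm{Neg}(X)$ is the set of pairs $(s_\varphi(X),r_\varphi(X))$ with $\neg\varphi\in\Gamma$, $T_\varphi\cup U_\varphi\supseteq V_\pi$ and $X\in R_\varphi(=S_\varphi)$; $\mathrm{Pairs}(X)=\mathrm{Pos}(X)\cup\mathrm{Neg}(X)$. $X$ can be chosen next if $X\in V\setminus V_\pi$ and: $X\notin W_\varphi$ for every $\varphi\in\overline{\Gamma}$; $\mathrm{Pairs}(X)$ (as a directed graph on $\underline{X}$) has no directed cycle; $|\mathrm{Best}(X)|\le1$ and $|\mathrm{Worst}(X)|\le1$; if $x\in\mathrm{Best}(X)$ then no pair $(x',x)$ is in $\mathrm{Pairs}(X)$; if $x\in\mathrm{Worst}(X)$ then no pair $(x,x')$ is in $\mathrm{Pairs}(X)$. $(X,\ge_X)$ is a valid extension of $\pi$ if $X$ can be chosen next, $\ge_X\supseteq\mathrm{Pairs}(X)$, the element of $\mathrm{Best}(X)$ (if any) is the $\ge_X$-greatest element of $\underline{X}$, and the element of $\mathrm{Worst}(X)$ (if any) is the $\ge_X$-least element of $\underline{X}$. -}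

module Defs where

open import Level using (0ℓ)
open import Data.Nat using (ℕ; _≤_)
open import Data.Fin using (Fin)
open import Data.Fin.Subset using (Subset) renaming (_∈_ to _∈ₛ_; _∉_ to _∉ₛ_)
open import Data.Maybe using (Maybe; just; nothing)
open import Data.List using (List; []; _∷_; _++_; map)
open import Data.List.Membership.Propositional using (_∈_; _∉_)
open import Data.List.Relation.Unary.All using (All)
open import Data.List.Relation.Unary.Unique.Propositional using (Unique)
open import Data.Product using (Σ; ∃; _×_; _,_; proj₁; proj₂)
open import Data.Sum using (_⊎_)
open import Data.Empty using (⊥)
open import Relation.Nullary using (¬_)
open import Relation.Binary.PropositionalEquality using (_≡_; _≢_)
open import Relation.Binary.Structures using (IsTotalOrder)
open import Relation.Binary.Construct.Closure.Transitive using (TransClosure)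

-- Variables are Fin n; variable i has the finite domain Fin (d i).
private variable
  n : ℕ
  d : Fin n → ℕ

record TotalOrd (k : ℕ) : Set₁ where
  field
    _≥_ : Fin k → Fin k → Set
    isTotalOrder : IsTotalOrder _≡_ _≥_

_>⟨_⟩_ : ∀ {k} → Fin k → TotalOrd k → Fin k → Set
a >⟨ o ⟩ b = TotalOrd._≥_ o a b × a ≢ b

Outcome : (n : ℕ) → (Fin n → ℕ) → Set
Outcome n d = (i : Fin n) → Fin (d i)

-- partial assignment: u i ≡ nothing means i is not in the domain of u
PAssign : (n : ℕ) → (Fin n → ℕ) → Set
PAssign n d = (i : Fin n) → Maybe (Fin (d i))

LexSeq : (n : ℕ) → (Fin n → ℕ) → Set₁
LexSeq n d = List (Σ (Fin n) (λ Y → TotalOrd (d Y)))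

vars : LexSeq n d → List (Fin n)
vars π = map proj₁ π

IsLex : LexSeq n d → Set
IsLex π = Unique (vars π)

Strict : LexSeq n d → Outcome n d → Outcome n d → Set
Strict []            α β = ⊥
Strict ((Y , o) ∷ π) α β = (α Y >⟨ o ⟩ β Y) ⊎ (α Y ≡ β Y × Strict π α β)

Equiv : LexSeq n d → Outcome n d → Outcome n d → Set
Equiv π α β = All (λ Y → α Y ≡ β Y) (vars π)

Weak : LexSeq n d → Outcome n d → Outcome n d → Set
Weak π α β = Strict π α β ⊎ Equiv π α β

data Kind : Set where
  nonStrict fullyStrict weaklyStrict : Kind

-- statement  u r ▷ u s ∥ T  (U, R, S are the domains of u, r, s)
record Stmt (n : ℕ) (d : Fin n → ℕ) : Set where
  field
    kind : Kind
    u r s : PAssign n d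
    T : Subset n
open Stmt public

IsJust : ∀ {A : Set} → Maybe A → Set
IsJust m = ∃ λ x → m ≡ just x

WellFormed : Stmt n d → Set
WellFormed {n} {d} φ =
  (∀ i → ¬ (IsJust (u φ i) × i ∈ₛ T φ)) ×
  (∀ i → ¬ (IsJust (u φ i) × (IsJust (r φ i) ⊎ IsJust (s φ i)))) ×
  (∀ i → ¬ (i ∈ₛ T φ × (IsJust (r φ i) ⊎ IsJust (s φ i)))) ×
  (∀ i x y → r φ i ≡ just x → s φ i ≡ just y → x ≢ y) ×
  (∀ i → d i ≡ 1 → i ∈ₛ T φ)

data Formula (n : ℕ) (d : Fin n → ℕ) : Set where
  pos : Stmt n d → Formula n d
  neg : Stmt n d → Formula n d

-- Γ ⊆ L'_pqT : negations only of non-strict statements with R = S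
InL' : List (Formula n d) → Set
InL' Γ = (∀ φ → pos φ ∈ Γ → WellFormed φ) ×
         (∀ φ → neg φ ∈ Γ → WellFormed φ × kind φ ≡ nonStrict ×
                              (∀ i → IsJust (r φ i) → IsJust (s φ i)) ×
                              (∀ i → IsJust (s φ i) → IsJust (r φ i)))

Extends : Outcome n d → PAssign n d → Set
Extends α p = ∀ i x → p i ≡ just x → α i ≡ x

InStar : Stmt n d → Outcome n d → Outcome n d → Set
InStar φ α β = Extends α (u φ) × Extends α (r φ) × Extends β (u φ) × Extends β (s φ) ×
               (∀ i → i ∈ₛ T φ → α i ≡ β i)

SatKind : Kind → LexSeq n d → Stmt n d → Set
SatKind nonStrict    π φ = ∀ α β → InStar φ α β → Weak π α β
SatKind fullyStrict  π φ = ∀ α β → InStar φ α β → Strict π α β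
SatKind weaklyStrict π φ = (∀ α β → InStar φ α β → Weak π α β) ×
                           (∃ λ α → ∃ λ β → InStar φ α β × Strict π α β)

_⊨_ : LexSeq n d → Formula n d → Set
π ⊨ pos φ = SatKind (kind φ) π φ
π ⊨ neg φ = ¬ SatKind (kind φ) π φ

_⊨*_ : LexSeq n d → Formula n d → Set₁
π ⊨* ψ = ∃ λ ext → IsLex (π ++ ext) × (π ++ ext) ⊨ ψ

_⊨*Γ_ : LexSeq n d → List (Formula n d) → Set₁
π ⊨*Γ Γ = ∀ ψ → ψ ∈ Γ → π ⊨* ψ

module _ (Γ : List (Formula n d)) (π : LexSeq n d) (X : Fin n) where

  GammaBar : Stmt n d → Set
  GammaBar φ = pos φ ∈ Γ × (∀ Y → IsJust (r φ Y) → IsJust (s φ Y) → Y ∉ vars π)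

  Best : Fin (d X) → Set
  Best x = ∃ λ φ → GammaBar φ × r φ X ≡ just x × s φ X ≡ nothing

  Worst : Fin (d X) → Set
  Worst x = ∃ λ φ → GammaBar φ × s φ X ≡ just x × r φ X ≡ nothing

  Pos : Fin (d X) → Fin (d X) → Set
  Pos a b = ∃ λ φ → GammaBar φ × r φ X ≡ just a × s φ X ≡ just b

  Neg : Fin (d X) → Fin (d X) → Set
  Neg a b = ∃ λ φ → neg φ ∈ Γ ×
            (∀ Y → Y ∈ vars π → Y ∈ₛ T φ ⊎ IsJust (u φ Y)) ×
            s φ X ≡ just a × r φ X ≡ just b

  Pairs : Fin (d X) → Fin (d X) → Set
  Pairs a b = Pos a b ⊎ Neg a b

  InW : Stmt n d → Set
  InW φ = r φ X ≡ nothing × s φ X ≡ nothing × X ∉ₛ T φ × u φ X ≡ nothing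

  CanBeChosenNext : Set
  CanBeChosenNext =
    X ∉ vars π ×
    (∀ φ → GammaBar φ → ¬ InW φ) ×
    (∀ a → ¬ TransClosure Pairs a a) ×
    (∀ x y → Best x → Best y → x ≡ y) ×
    (∀ x y → Worst x → Worst y → x ≡ y) ×
    (∀ x → Best x → ∀ x' → ¬ Pairs x' x) ×
    (∀ x → Worst x → ∀ x' → ¬ Pairs x x')

  ValidExtension : TotalOrd (d X) → Set
  ValidExtension o =
    CanBeChosenNext ×
    (∀ a b → Pairs a b → TotalOrd._≥_ o a b) ×
    (∀ x → Best x → ∀ y → TotalOrd._≥_ o x y) ×
    (∀ x → Worst x → ∀ y → TotalOrd._≥_ o y x)

{-# OPTIONS --safe #-}
-- Write π′ = π ∘ (X, ≥X). If a lex model beginning with π′ satisfies a positive statement φ,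
-- then every pair of φ* that π leaves tied is weakly ordered at X by ≥X. Testing this on a
-- canonical pair of φ* (one that π leaves tied when φ ∈ Γ̄), changed at X where φ leaves X
-- free, yields the Pos, Best and Worst constraints and excludes X ∈ W_φ; a Neg pair ordered the
-- wrong way would make the model satisfy a negated statement. Acyclicity and the uniqueness of
-- Best and Worst then hold because all constraints are realised by the single total order ≥X.
--
-- Conversely, a lex model π ++ σ of a formula is turned into one beginning with π′ by moving X
-- forward: π′ ++ (σ without X). Pairs agreeing at X compare as before, and pairs tied on π but
-- not at X are now decided at X, in the right direction by validity (outside Γ̄, φ already
-- separates all its pairs within π). For a negated φ one shows that if the moved model satisfied
-- φ, all pairs tied on π would also tie at X, so π ++ σ would satisfy φ too.
module Submission where

open import Defs
open import Data.Nat using (ℕ; _≤_; s≤s; z≤n)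
open import Data.Nat.Properties using (≤∧≢⇒<)
open import Data.Fin using (Fin; zero; suc; _≟_; fromℕ<)
open import Data.Fin.Subset using () renaming (_∈_ to _∈ₛ_; _∉_ to _∉ₛ_)
open import Data.Fin.Subset.Properties using (_∈?_)
open import Data.Maybe using (Maybe; just; nothing; fromMaybe; _<∣>_)
open import Data.List using (List; []; _∷_; _++_; _∷ʳ_; filter)
open import Data.List.Properties using (∷ʳ-++; filter-++; filter-idem; filter-reject)
open import Data.List.Membership.Propositional using (_∈_; _∉_)
open import Data.List.Relation.Unary.Any using (here; there)
open import Data.List.Relation.Unary.All as All using (All; []; _∷_; all?)
open import Data.List.Relation.Unary.AllPairs using ([]; _∷_)
open import Data.Product using (Σ; ∃₂; _×_; _,_; proj₁; proj₂)
open import Data.Product.Function.NonDependent.Propositional using (_×-⇔_)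
open import Data.Sum using (_⊎_; inj₁; inj₂; [_,_]′)
open import Data.Sum.Function.Propositional using (_⊎-⇔_)
open import Data.Empty using (⊥-elim)
open import Function using (_∘_; case_of_)
open import Function.Bundles using (_⇔_; mk⇔; Equivalence)
open import Function.Construct.Identity using (⇔-id)
open import Function.Construct.Symmetry using (⇔-sym)
open import Function.Construct.Composition using (_⇔-∘_)
open import Relation.Nullary using (¬_; Dec; yes; no; ¬?)
open import Relation.Nullary.Decidable using (_⊎-dec_; decidable-stable)
open import Relation.Unary using (Decidable)
open import Relation.Binary.Structures using (IsTotalOrder)
open import Relation.Binary.PropositionalEquality
  using (_≡_; _≢_; refl; sym; trans; cong; subst; subst₂; module ≡-Reasoning)
open import Relation.Binary.Construct.Closure.Transitive using (TransClosure; [_]; _∷_)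
import Relation.Binary.Construct.NonStrictToStrict as NonStrictToStrict

private variable
  n k : ℕ
  d : Fin n → ℕ
  X Y : Fin n
  α β : Outcome n d
  π σ ρ : LexSeq n d

_≥⟨_⟩_ : Fin k → TotalOrd k → Fin k → Set
a ≥⟨ o ⟩ b = TotalOrd._≥_ o a b

module _ (o : TotalOrd k) where
  open IsTotalOrder (TotalOrd.isTotalOrder o)
    using (reflexive; antisym; total) renaming (trans to ≥-trans)
  open NonStrictToStrict _≡_ (TotalOrd._≥_ o) using (≮⇒≥; ≤⇒≯; <-asym)

  ≥-reflexive : ∀ {a b} → a ≡ b → a ≥⟨ o ⟩ b
  ≥-reflexive = reflexive

  ≥-antisym : ∀ {a b} → a ≥⟨ o ⟩ b → b ≥⟨ o ⟩ a → a ≡ b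
  ≥-antisym = antisym

  >-asym : ∀ {a b} → a >⟨ o ⟩ b → ¬ b >⟨ o ⟩ a
  >-asym = <-asym antisym

  ≯⇒≥ : ∀ {a b} → ¬ b >⟨ o ⟩ a → a ≥⟨ o ⟩ b
  ≯⇒≥ = ≮⇒≥ sym _≟_ reflexive total

  ≥⇒≯ : ∀ {a b} → a ≥⟨ o ⟩ b → ¬ b >⟨ o ⟩ a
  ≥⇒≯ = ≤⇒≯ antisym

  strict-pair : 2 ≤ k → ∃₂ λ p q → q >⟨ o ⟩ p
  strict-pair (s≤s (s≤s z≤n)) with total zero (suc zero)
  ... | inj₁ 0≥1 = suc zero , zero , 0≥1 , λ ()
  ... | inj₂ 1≥0 = zero , suc zero , 1≥0 , λ ()

  top-unique : ∀ {x x′} → (∀ y → x ≥⟨ o ⟩ y) → (∀ y → x′ ≥⟨ o ⟩ y) → x ≡ x′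
  top-unique top top′ = antisym (top _) (top′ _)

  bottom-unique : ∀ {x x′} → (∀ y → y ≥⟨ o ⟩ x) → (∀ y → y ≥⟨ o ⟩ x′) → x ≡ x′
  bottom-unique bot bot′ = antisym (bot′ _) (bot _)

  module _ {R : Fin k → Fin k → Set}
           (R-irrefl : ∀ a → ¬ R a a) (R⊆≥ : ∀ {a b} → R a b → a ≥⟨ o ⟩ b) where

    R⁺⊆≥ : ∀ {a b} → TransClosure R a b → a ≥⟨ o ⟩ b
    R⁺⊆≥ [ aRb ]      = R⊆≥ aRb
    R⁺⊆≥ (aRb ∷ bR⁺c) = ≥-trans (R⊆≥ aRb) (R⁺⊆≥ bR⁺c)

    R⁺-irrefl : ∀ a → ¬ TransClosure R a a
    R⁺-irrefl a [ aRa ]      = R-irrefl a aRa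
    R⁺-irrefl a (aRb ∷ bR⁺a) =
      R-irrefl a (subst (R a) (sym (antisym (R⊆≥ aRb) (R⁺⊆≥ bR⁺a))) aRb)

    R-into-top : ∀ {x} → (∀ y → x ≥⟨ o ⟩ y) → ∀ x′ → ¬ R x′ x
    R-into-top top x′ x′Rx =
      R-irrefl _ (subst (λ z → R z _) (antisym (R⊆≥ x′Rx) (top x′)) x′Rx)

    R-out-of-bottom : ∀ {x} → (∀ y → y ≥⟨ o ⟩ x) → ∀ x′ → ¬ R x x′
    R-out-of-bottom bot x′ xRx′ =
      R-irrefl _ (subst (R _) (sym (antisym (R⊆≥ xRx′) (bot x′))) xRx′)

Equiv-sym : Equiv ρ α β → Equiv ρ β α
Equiv-sym = All.map sym

Equiv? : (ρ : LexSeq n d) (α β : Outcome n d) → Dec (Equiv ρ α β)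
Equiv? ρ α β = all? (λ Y → α Y ≟ β Y) (vars ρ)

Strict-asym : (ρ : LexSeq n d) → Strict ρ α β → ¬ Strict ρ β α
Strict-asym ((_ , o) ∷ ρ) (inj₁ a>b)        (inj₁ b>a)        = >-asym o a>b b>a
Strict-asym (_ ∷ ρ)       (inj₁ (_ , a≢b)) (inj₂ (b≡a , _)) = a≢b (sym b≡a)
Strict-asym (_ ∷ ρ)       (inj₂ (a≡b , _)) (inj₁ (_ , b≢a)) = b≢a (sym a≡b)
Strict-asym (_ ∷ ρ)       (inj₂ (_ , s))   (inj₂ (_ , s′))   = Strict-asym ρ s s′

Strict⇒¬Equiv : (ρ : LexSeq n d) → Strict ρ α β → ¬ Equiv ρ α β
Strict⇒¬Equiv (_ ∷ ρ) (inj₁ (_ , a≢b)) (a≡b ∷ _) = a≢b a≡b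
Strict⇒¬Equiv (_ ∷ ρ) (inj₂ (_ , s))   (_ ∷ E)   = Strict⇒¬Equiv ρ s E

Strict⇒¬Weak : (ρ : LexSeq n d) → Strict ρ β α → ¬ Weak ρ α β
Strict⇒¬Weak ρ s (inj₁ s′) = Strict-asym ρ s s′
Strict⇒¬Weak ρ s (inj₂ E)  = Strict⇒¬Equiv ρ s (Equiv-sym E)

Strict-++ : (π : LexSeq n d) → Strict π α β → Strict (π ++ σ) α β
Strict-++ (_ ∷ π) (inj₁ a>b)     = inj₁ a>b
Strict-++ (_ ∷ π) (inj₂ (e , s)) = inj₂ (e , Strict-++ π s)

Equiv-++⁻ : (π : LexSeq n d) → Equiv (π ++ σ) α β → Equiv π α β
Equiv-++⁻ []      _       = []
Equiv-++⁻ (_ ∷ π) (e ∷ E) = e ∷ Equiv-++⁻ π E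

Weak-++⇒Strict : (π : LexSeq n d) → ¬ Equiv π α β → Weak (π ++ σ) α β → Strict π α β
Weak-++⇒Strict []      ¬E _                     = ⊥-elim (¬E [])
Weak-++⇒Strict (_ ∷ π) ¬E (inj₁ (inj₁ a>b))     = inj₁ a>b
Weak-++⇒Strict (_ ∷ π) ¬E (inj₁ (inj₂ (e , s))) =
  inj₂ (e , Weak-++⇒Strict π (¬E ∘ (e ∷_)) (inj₁ s))
Weak-++⇒Strict π       ¬E (inj₂ E)              = ⊥-elim (¬E (Equiv-++⁻ π E))

Strict-next : (π : LexSeq n d) {o : TotalOrd (d X)} →
              Equiv π α β → α X >⟨ o ⟩ β X → Strict (π ++ (X , o) ∷ σ) α β
Strict-next []      []      a>b = inj₁ a>b
Strict-next (_ ∷ π) (e ∷ E) a>b = inj₂ (e , Strict-next π E a>b)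

Weak-next⇒≥ : (π : LexSeq n d) {o : TotalOrd (d X)} →
              Equiv π α β → Weak (π ++ (X , o) ∷ σ) α β → α X ≥⟨ o ⟩ β X
Weak-next⇒≥ π {o} E w = ≯⇒≥ o λ b>a → Strict⇒¬Weak _ (Strict-next π (Equiv-sym E) b>a) w

Weak⇒Strict-next : (π : LexSeq n d) {o : TotalOrd (d X)} →
                   (Equiv π α β → α X >⟨ o ⟩ β X) →
                   Weak (π ++ σ) α β → Strict (π ++ (X , o) ∷ ρ) α β
Weak⇒Strict-next {α = α} {β = β} π H w with Equiv? π α β
... | yes E = Strict-next π E (H E)
... | no ¬E = Strict-++ π (Weak-++⇒Strict π ¬E w)

notAt? : (X : Fin n) →
         Decidable {A = Σ (Fin n) (λ Y → TotalOrd (d Y))} (λ entry → proj₁ entry ≢ X)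
notAt? X (Y , _) = ¬? (Y ≟ X)

without : Fin n → LexSeq n d → LexSeq n d
without X = filter (notAt? X)

Strict-without : {α β : Outcome n d} → α X ≡ β X →
                 (ρ : LexSeq n d) → Strict (without X ρ) α β ⇔ Strict ρ α β
Strict-without e [] = ⇔-id _
Strict-without {X = X} {α = α} {β = β} e ((Y , o) ∷ ρ) with Y ≟ X
... | yes refl = mk⇔ (λ s → inj₂ (e , to s))
                     λ { (inj₁ (_ , a≢b)) → ⊥-elim (a≢b e) ; (inj₂ (_ , s)) → from s }
  where open Equivalence (Strict-without {α = α} {β = β} e ρ)
... | no _ = ⇔-id _ ⊎-⇔ (⇔-id _ ×-⇔ Strict-without e ρ)

Equiv-without : {α β : Outcome n d} → α X ≡ β X →
                (ρ : LexSeq n d) → Equiv (without X ρ) α β ⇔ Equiv ρ α β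
Equiv-without e [] = ⇔-id _
Equiv-without {X = X} {α = α} {β = β} e ((Y , o) ∷ ρ) with Y ≟ X
... | yes refl = mk⇔ ((e ∷_) ∘ to) λ { (_ ∷ E) → from E }
  where open Equivalence (Equiv-without {α = α} {β = β} e ρ)
... | no _ = mk⇔ (λ { (e′ ∷ E) → e′ ∷ to E }) λ { (e′ ∷ E) → e′ ∷ from E }
  where open Equivalence (Equiv-without {α = α} {β = β} e ρ)

Weak-without : α X ≡ β X → (ρ : LexSeq n d) → Weak (without X ρ) α β ⇔ Weak ρ α β
Weak-without e ρ = Strict-without e ρ ⊎-⇔ Equiv-without e ρ

without-reinsert : (π σ : LexSeq n d) (o : TotalOrd (d X)) →
                   without X (π ++ (X , o) ∷ without X σ) ≡ without X (π ++ σ)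
without-reinsert {X = X} π σ o = begin
  without X (π ++ (X , o) ∷ without X σ)
    ≡⟨ filter-++ (notAt? X) π _ ⟩
  without X π ++ without X ((X , o) ∷ without X σ)
    ≡⟨ cong (without X π ++_) (filter-reject (notAt? X) λ X≢X → X≢X refl) ⟩
  without X π ++ without X (without X σ)
    ≡⟨ cong (without X π ++_) (filter-idem (notAt? X) σ) ⟩
  without X π ++ without X σ
    ≡⟨ filter-++ (notAt? X) π σ ⟨
  without X (π ++ σ)
    ∎
  where open ≡-Reasoning

reinsert-⇔ : (π σ : LexSeq n d) {o : TotalOrd (d X)} (P : LexSeq n d → Set) →
             (∀ ρ → P (without X ρ) ⇔ P ρ) → P (π ++ σ) ⇔ P (π ++ (X , o) ∷ without X σ)
reinsert-⇔ {X = X} π σ {o} P invariant =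
  subst (λ ρ → P ρ ⇔ P (π ++ (X , o) ∷ without X σ)) (without-reinsert π σ o) (invariant _)
    ⇔-∘ ⇔-sym (invariant (π ++ σ))

module _ (π σ : LexSeq n d) {o : TotalOrd (d X)} where

  Strict-promote : (Equiv π α β → α X ≢ β X → α X >⟨ o ⟩ β X) →
                   Strict (π ++ σ) α β → Strict (π ++ (X , o) ∷ without X σ) α β
  Strict-promote {α = α} {β = β} H s with α X ≟ β X
  ... | yes e = Equivalence.to (reinsert-⇔ π σ (λ ρ → Strict ρ α β) (Strict-without e)) s
  ... | no ne = Weak⇒Strict-next π (λ E → H E ne) (inj₁ s)

  Weak-promote : (Equiv π α β → α X ≢ β X → α X >⟨ o ⟩ β X) →
                 Weak (π ++ σ) α β → Weak (π ++ (X , o) ∷ without X σ) α β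
  Weak-promote {α = α} {β = β} H w with α X ≟ β X
  ... | yes e = Equivalence.to (reinsert-⇔ π σ (λ ρ → Weak ρ α β) (Weak-without e)) w
  ... | no ne = inj₁ (Weak⇒Strict-next π (λ E → H E ne) w)

  Weak-demote : (Equiv π α β → α X ≡ β X) →
                Weak (π ++ (X , o) ∷ without X σ) α β → Weak (π ++ σ) α β
  Weak-demote {α = α} {β = β} H w with α X ≟ β X
  ... | yes e = Equivalence.from (reinsert-⇔ π σ (λ ρ → Weak ρ α β) (Weak-without e)) w
  ... | no ne = inj₁ (Strict-++ π (Weak-++⇒Strict π (ne ∘ H) w))

All-without : ∀ {P : Fin n → Set} (σ : LexSeq n d) → All P (vars σ) → All P (vars (without X σ))
All-without []            []         = []
All-without {X = X} ((Y , _) ∷ σ) (pY ∷ ps) with Y ≟ X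
... | yes _ = All-without σ ps
... | no _  = pY ∷ All-without σ ps

without-∌ : (σ : LexSeq n d) → All (X ≢_) (vars (without X σ))
without-∌ [] = []
without-∌ {X = X} ((Y , _) ∷ σ) with Y ≟ X
... | yes _   = without-∌ σ
... | no Y≢X = (Y≢X ∘ sym) ∷ without-∌ σ

IsLex-without : (σ : LexSeq n d) → IsLex σ → IsLex (without X σ)
IsLex-without []            []         = []
IsLex-without {X = X} ((Y , _) ∷ σ) (Y∉ ∷ lex) with Y ≟ X
... | yes _ = IsLex-without σ lex
... | no _  = All-without σ Y∉ ∷ IsLex-without σ lex

All-reinsert : ∀ {P : Fin n → Set} (π σ : LexSeq n d) {o : TotalOrd (d X)} →
               All P (vars (π ++ σ)) → P X → All P (vars (π ++ (X , o) ∷ without X σ))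
All-reinsert []      σ ps       pX = pX ∷ All-without σ ps
All-reinsert (_ ∷ π) σ (p ∷ ps) pX = p ∷ All-reinsert π σ ps pX

IsLex-reinsert : (π σ : LexSeq n d) {o : TotalOrd (d X)} →
                 X ∉ vars π → IsLex (π ++ σ) → IsLex (π ++ (X , o) ∷ without X σ)
IsLex-reinsert []      σ _   lex        = without-∌ σ ∷ IsLex-without σ lex
IsLex-reinsert (_ ∷ π) σ X∉ (Y∉ ∷ lex) =
  All-reinsert π σ Y∉ (X∉ ∘ here ∘ sym) ∷ IsLex-reinsert π σ (X∉ ∘ there) lex

_[_≔_] : Outcome n d → (Y : Fin n) → Fin (d Y) → Outcome n d
(α [ Y ≔ v ]) i with i ≟ Y
... | yes refl = v
... | no _     = α i

[≔]-same : (α : Outcome n d) (Y : Fin n) (v : Fin (d Y)) → (α [ Y ≔ v ]) Y ≡ v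
[≔]-same α Y v with Y ≟ Y
... | yes refl = refl
... | no Y≢Y   = ⊥-elim (Y≢Y refl)

[≔]-other : ∀ {α : Outcome n d} {v : Fin (d Y)} {i} → i ≢ Y → (α [ Y ≔ v ]) i ≡ α i
[≔]-other {Y = Y} {i = i} i≢Y with i ≟ Y
... | yes i≡Y = ⊥-elim (i≢Y i≡Y)
... | no _    = refl

Equiv-[≔]ˡ : ∀ {π : LexSeq n d} {α β : Outcome n d} {v : Fin (d Y)} →
             Y ∉ vars π → Equiv π α β → Equiv π (α [ Y ≔ v ]) β
Equiv-[≔]ˡ {α = α} {v = v} Y∉π E =
  All.tabulate λ Z∈π →
    trans ([≔]-other {α = α} {v = v} λ { refl → Y∉π Z∈π }) (All.lookup E Z∈π)

Equiv-[≔]ʳ : ∀ {π : LexSeq n d} {α β : Outcome n d} {v : Fin (d Y)} →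
             Y ∉ vars π → Equiv π α β → Equiv π α (β [ Y ≔ v ])
Equiv-[≔]ʳ Y∉π = Equiv-sym ∘ Equiv-[≔]ˡ Y∉π ∘ Equiv-sym

Strict-reversed-at : {α β : Outcome n d} (ρ : LexSeq n d) → Y ∈ vars ρ → 2 ≤ d Y → Equiv ρ α β →
                     ∃₂ λ p q → Strict ρ (β [ Y ≔ q ]) (α [ Y ≔ p ])
Strict-reversed-at {Y = Y} ((Z , o) ∷ ρ) Y∈ 2≤dY (e ∷ E) with Z ≟ Y
-- The with on Z ≟ Y has already evaluated both updates at Z.
... | yes refl = let p , q , q>p = strict-pair o 2≤dY in p , q , inj₁ q>p
... | no Z≢Y with Y∈
...   | here Y≡Z  = ⊥-elim (Z≢Y (sym Y≡Z))
...   | there Y∈ρ =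
  let p , q , β′≻α′ = Strict-reversed-at ρ Y∈ρ 2≤dY E
  in p , q , inj₂ (sym e , β′≻α′)

-- Definitionally InW Γ π Y φ, which depends on neither Γ nor π.
_∈W_ : Fin n → Stmt n d → Set
Y ∈W φ = r φ Y ≡ nothing × s φ Y ≡ nothing × Y ∉ₛ T φ × u φ Y ≡ nothing

Unfixed : Stmt n d → Fin n → Set
Unfixed φ Y = u φ Y ≡ nothing × Y ∉ₛ T φ

module WF {n} {d : Fin n → ℕ} (φ : Stmt n d) (wf : WellFormed φ) where

  u-disjoint-rs : ∀ i → ¬ (IsJust (u φ i) × (IsJust (r φ i) ⊎ IsJust (s φ i)))
  u-disjoint-rs = proj₁ (proj₂ wf)

  T-disjoint-rs : ∀ i → ¬ (i ∈ₛ T φ × (IsJust (r φ i) ⊎ IsJust (s φ i)))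
  T-disjoint-rs = proj₁ (proj₂ (proj₂ wf))

  r≢s : ∀ i x y → r φ i ≡ just x → s φ i ≡ just y → x ≢ y
  r≢s = proj₁ (proj₂ (proj₂ (proj₂ wf)))

  singleton∈T : ∀ i → d i ≡ 1 → i ∈ₛ T φ
  singleton∈T = proj₂ (proj₂ (proj₂ (proj₂ wf)))

IsJust? : {A : Set} (m : Maybe A) → Dec (IsJust m)
IsJust? (just x) = yes (x , refl)
IsJust? nothing  = no λ { (_ , ()) }

IsJust-contrapositive : {A B : Set} {m : Maybe A} {m′ : Maybe B} →
                        (IsJust m → IsJust m′) → m′ ≡ nothing → m ≡ nothing
IsJust-contrapositive {m = nothing} _ _ = refl
IsJust-contrapositive {m = just x} j m′≡nothing with j (x , refl)
... | _ , m′≡just = case trans (sym m′≡nothing) m′≡just of λ ()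

defined⇒Unfixed : {φ : Stmt n d} → WellFormed φ → IsJust (r φ Y) ⊎ IsJust (s φ Y) → Unfixed φ Y
defined⇒Unfixed {Y = Y} {φ = φ} wf rs with u φ Y in uY
... | just x  = ⊥-elim (WF.u-disjoint-rs φ wf Y ((x , uY) , rs))
... | nothing = refl , λ Y∈T → WF.T-disjoint-rs φ wf Y (Y∈T , rs)

outside-T⇒nontrivial : {φ : Stmt n d} → WellFormed φ → 1 ≤ d Y → Y ∉ₛ T φ → 2 ≤ d Y
outside-T⇒nontrivial {Y = Y} {φ = φ} wf 1≤dY Y∉T =
  ≤∧≢⇒< 1≤dY λ 1≡dY → Y∉T (WF.singleton∈T φ wf Y (sym 1≡dY))

Extends-[≔] : {α : Outcome n d} {p : PAssign n d} {v : Fin (d Y)} →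
              p Y ≡ nothing → Extends α p → Extends (α [ Y ≔ v ]) p
Extends-[≔] {Y = Y} pY≡nothing ext i x pi≡just with i ≟ Y
... | yes refl = case trans (sym pY≡nothing) pi≡just of λ ()
... | no _     = ext i x pi≡just

InStar-[≔]ˡ : {φ : Stmt n d} {α β : Outcome n d} {v : Fin (d Y)} →
              Unfixed φ Y → r φ Y ≡ nothing → InStar φ α β → InStar φ (α [ Y ≔ v ]) β
InStar-[≔]ˡ {α = α} {v = v} (uY , Y∉T) rY (αu , αr , βu , βs , αβT) =
  Extends-[≔] uY αu , Extends-[≔] rY αr , βu , βs ,
  λ i i∈T → trans ([≔]-other {α = α} {v = v} λ { refl → Y∉T i∈T }) (αβT i i∈T)

InStar-[≔]ʳ : {φ : Stmt n d} {α β : Outcome n d} {v : Fin (d Y)} →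
              Unfixed φ Y → s φ Y ≡ nothing → InStar φ α β → InStar φ α (β [ Y ≔ v ])
InStar-[≔]ʳ {β = β} {v = v} (uY , Y∉T) sY (αu , αr , βu , βs , αβT) =
  αu , αr , Extends-[≔] uY βu , Extends-[≔] sY βs ,
  λ i i∈T → trans (αβT i i∈T) (sym ([≔]-other {α = β} {v = v} λ { refl → Y∉T i∈T }))

InStar-[≔]-W : {φ : Stmt n d} {α β : Outcome n d} {p q : Fin (d Y)} →
               Y ∈W φ → InStar φ α β → InStar φ (α [ Y ≔ p ]) (β [ Y ≔ q ])
InStar-[≔]-W {φ = φ} {p = p} {q} (rY , sY , Y∉T , uY) =
  InStar-[≔]ʳ {φ = φ} {v = q} (uY , Y∉T) sY ∘ InStar-[≔]ˡ {φ = φ} {v = p} (uY , Y∉T) rY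

covered⇒Equiv : {π : LexSeq n d} {φ : Stmt n d} {α β : Outcome n d} →
                (∀ Y → Y ∈ vars π → Y ∈ₛ T φ ⊎ IsJust (u φ Y)) → InStar φ α β → Equiv π α β
covered⇒Equiv covered (αu , _ , βu , _ , αβT) =
  All.tabulate λ {Y} Y∈π →
    [ αβT Y , (λ (x , uY) → trans (αu Y x uY) (sym (βu Y x uY))) ]′ (covered Y Y∈π)

both-defined⇒∉ : {π : LexSeq n d} {φ : Stmt n d} {α β : Outcome n d} →
                 WellFormed φ → InStar φ α β → Equiv π α β →
                 ∀ Y → IsJust (r φ Y) → IsJust (s φ Y) → Y ∉ vars π
both-defined⇒∉ {φ = φ} wf (_ , αr , _ , βs , _) E Y (a , rY) (b , sY) Y∈π =
  WF.r≢s φ wf Y a b rY sY (trans (sym (αr Y a rY)) (trans (All.lookup E Y∈π) (βs Y b sY)))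

module _ (nonempty : ∀ i → 1 ≤ d i) (φ : Stmt n d) where

  witnessˡ witnessʳ : Outcome n d
  witnessˡ i = fromMaybe (fromℕ< (nonempty i)) (u φ i <∣> r φ i <∣> s φ i)
  witnessʳ i = fromMaybe (fromℕ< (nonempty i)) (u φ i <∣> s φ i <∣> r φ i)

  witness-agree : ∀ i → ¬ (IsJust (r φ i) × IsJust (s φ i)) → witnessˡ i ≡ witnessʳ i
  witness-agree i ¬both with u φ i
  ... | just _  = refl
  ... | nothing with r φ i | s φ i
  ...   | just a  | just b  = ⊥-elim (¬both ((a , refl) , (b , refl)))
  ...   | just _  | nothing = refl
  ...   | nothing | just _  = refl
  ...   | nothing | nothing = refl

  witnessˡ-u : Extends witnessˡ (u φ)
  witnessˡ-u i x ui rewrite ui = refl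

  witnessʳ-u : Extends witnessʳ (u φ)
  witnessʳ-u i x ui rewrite ui = refl

  witnessˡ-r : WellFormed φ → Extends witnessˡ (r φ)
  witnessˡ-r wf i a ri with u φ i in ui
  ... | just x  = ⊥-elim (WF.u-disjoint-rs φ wf i ((x , ui) , inj₁ (a , ri)))
  ... | nothing rewrite ri = refl

  witnessʳ-s : WellFormed φ → Extends witnessʳ (s φ)
  witnessʳ-s wf i b si with u φ i in ui
  ... | just x  = ⊥-elim (WF.u-disjoint-rs φ wf i ((x , ui) , inj₂ (b , si)))
  ... | nothing rewrite si = refl

  witness-InStar : WellFormed φ → InStar φ witnessˡ witnessʳ
  witness-InStar wf =
    witnessˡ-u , witnessˡ-r wf , witnessʳ-u , witnessʳ-s wf ,
    λ i i∈T → witness-agree i λ (rj , _) → WF.T-disjoint-rs φ wf i (i∈T , inj₁ rj)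

SatKind⇒Weak : {ρ : LexSeq n d} {φ : Stmt n d} {α β : Outcome n d} →
               ∀ κ → SatKind κ ρ φ → InStar φ α β → Weak ρ α β
SatKind⇒Weak nonStrict    sat       st = sat _ _ st
SatKind⇒Weak fullyStrict  sat       st = inj₁ (sat _ _ st)
SatKind⇒Weak weaklyStrict (sat , _) st = sat _ _ st

SatKind-mono : {ρ ρ′ : LexSeq n d} {φ : Stmt n d} → ∀ κ →
               (∀ {α β} → InStar φ α β → Weak ρ α β → Weak ρ′ α β) →
               (∀ {α β} → InStar φ α β → Strict ρ α β → Strict ρ′ α β) →
               SatKind κ ρ φ → SatKind κ ρ′ φ
SatKind-mono nonStrict    weak _      sat α β st = weak st (sat α β st)
SatKind-mono fullyStrict  _    strict sat α β st = strict st (sat α β st)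
SatKind-mono weaklyStrict weak strict (sat , α , β , st , α≻β) =
  (λ α β st → weak st (sat α β st)) , α , β , st , strict st α≻β

module Extension {n} {d : Fin n → ℕ} (nonempty : ∀ i → 1 ≤ d i)
                 (Γ : List (Formula n d)) (Γ∈L′ : InL' Γ)
                 (π : LexSeq n d) (X : Fin n) (X∉π : X ∉ vars π) (o : TotalOrd (d X)) where

  private
    wf⁺ : {φ : Stmt n d} → pos φ ∈ Γ → WellFormed φ
    wf⁺ = proj₁ Γ∈L′ _

    wf⁻ : {φ : Stmt n d} → neg φ ∈ Γ → WellFormed φ
    wf⁻ φ∈Γ = proj₁ (proj₂ Γ∈L′ _ φ∈Γ)

    nonStrict⁻ : {φ : Stmt n d} → neg φ ∈ Γ → kind φ ≡ nonStrict
    nonStrict⁻ φ∈Γ = proj₁ (proj₂ (proj₂ Γ∈L′ _ φ∈Γ))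

    r⇒s⁻ : {φ : Stmt n d} → neg φ ∈ Γ → ∀ i → IsJust (r φ i) → IsJust (s φ i)
    r⇒s⁻ φ∈Γ = proj₁ (proj₂ (proj₂ (proj₂ Γ∈L′ _ φ∈Γ)))

    s⇒r⁻ : {φ : Stmt n d} → neg φ ∈ Γ → ∀ i → IsJust (s φ i) → IsJust (r φ i)
    s⇒r⁻ φ∈Γ = proj₂ (proj₂ (proj₂ (proj₂ Γ∈L′ _ φ∈Γ)))

  SatKind⁻⇔ : {ρ : LexSeq n d} {φ : Stmt n d} → neg φ ∈ Γ →
              SatKind (kind φ) ρ φ ⇔ (∀ α β → InStar φ α β → Weak ρ α β)
  SatKind⁻⇔ {ρ} {φ} φ∈Γ =
    subst (λ κ → SatKind κ ρ φ ⇔ SatKind nonStrict ρ φ) (sym (nonStrict⁻ φ∈Γ)) (⇔-id _)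

  TiedPairsOrdered : Stmt n d → Set
  TiedPairsOrdered φ = ∀ α β → InStar φ α β → Equiv π α β → α X ≥⟨ o ⟩ β X

  Weak-next⇒TiedPairsOrdered : {σ : LexSeq n d} {φ : Stmt n d} →
                               (∀ α β → InStar φ α β → Weak (π ++ (X , o) ∷ σ) α β) →
                               TiedPairsOrdered φ
  Weak-next⇒TiedPairsOrdered weak α β st E = Weak-next⇒≥ π E (weak α β st)

  TiedPairsOrdered⇒∉W : {φ : Stmt n d} {α β : Outcome n d} → WellFormed φ → TiedPairsOrdered φ →
                        InStar φ α β → Equiv π α β → ¬ X ∈W φ
  TiedPairsOrdered⇒∉W {φ} {α} {β} wf ordered st E X∈W@(_ , _ , X∉T , _) =
    let p , q , q>p = strict-pair o (outside-T⇒nontrivial {φ = φ} wf (nonempty X) X∉T)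
        p≥q = subst₂ (_≥⟨ o ⟩_) ([≔]-same α X p) ([≔]-same β X q)
                (ordered _ _ (InStar-[≔]-W {φ = φ} X∈W st) (Equiv-[≔]ˡ X∉π (Equiv-[≔]ʳ X∉π E)))
    in ≥⇒≯ o p≥q q>p

  GammaBar⇒witness-Equiv : {φ : Stmt n d} → GammaBar Γ π X φ →
                           Equiv π (witnessˡ nonempty φ) (witnessʳ nonempty φ)
  GammaBar⇒witness-Equiv {φ} (_ , rs∉π) =
    All.tabulate λ {Y} Y∈π → witness-agree nonempty φ Y λ (rY , sY) → rs∉π Y rY sY Y∈π

  Pairs-irrefl : ∀ a → ¬ Pairs Γ π X a a
  Pairs-irrefl a (inj₁ (φ , (φ∈Γ , _) , rX , sX)) = WF.r≢s φ (wf⁺ φ∈Γ) X a a rX sX refl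
  Pairs-irrefl a (inj₂ (φ , φ∈Γ , _ , sX , rX))   = WF.r≢s φ (wf⁻ φ∈Γ) X a a rX sX refl

  module Necessity (π′⊨*Γ : (π ∷ʳ (X , o)) ⊨*Γ Γ) where

    pos⇒TiedPairsOrdered : {φ : Stmt n d} → pos φ ∈ Γ → TiedPairsOrdered φ
    pos⇒TiedPairsOrdered {φ} φ∈Γ with π′⊨*Γ (pos φ) φ∈Γ
    ... | σ , _ , sat = Weak-next⇒TiedPairsOrdered {σ = σ} {φ = φ} λ α β st →
      subst (λ ρ → Weak ρ α β) (∷ʳ-++ π (X , o) σ) (SatKind⇒Weak (kind φ) sat st)

    GammaBar⇒∉W : ∀ φ → GammaBar Γ π X φ → ¬ X ∈W φ
    GammaBar⇒∉W φ γ@(φ∈Γ , _) =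
      TiedPairsOrdered⇒∉W {φ = φ} (wf⁺ φ∈Γ) (pos⇒TiedPairsOrdered φ∈Γ)
        (witness-InStar nonempty φ (wf⁺ φ∈Γ)) (GammaBar⇒witness-Equiv γ)

    Pos⇒≥ : ∀ {a b} → Pos Γ π X a b → a ≥⟨ o ⟩ b
    Pos⇒≥ (φ , γ@(φ∈Γ , _) , rX , sX) =
      subst₂ (_≥⟨ o ⟩_) (witnessˡ-r nonempty φ wf X _ rX) (witnessʳ-s nonempty φ wf X _ sX)
        (pos⇒TiedPairsOrdered φ∈Γ _ _ (witness-InStar nonempty φ wf) (GammaBar⇒witness-Equiv γ))
      where
      wf : WellFormed φ
      wf = wf⁺ φ∈Γ

    Best⇒≥ : ∀ x → Best Γ π X x → ∀ y → x ≥⟨ o ⟩ y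
    Best⇒≥ _ (φ , γ@(φ∈Γ , _) , rX , sX) y =
      subst₂ (_≥⟨ o ⟩_) (witnessˡ-r nonempty φ wf X _ rX) ([≔]-same (witnessʳ nonempty φ) X y)
        (pos⇒TiedPairsOrdered φ∈Γ _ _
          (InStar-[≔]ʳ {φ = φ} (defined⇒Unfixed {φ = φ} wf (inj₁ (_ , rX))) sX
            (witness-InStar nonempty φ wf))
          (Equiv-[≔]ʳ X∉π (GammaBar⇒witness-Equiv γ)))
      where
      wf : WellFormed φ
      wf = wf⁺ φ∈Γ

    Worst⇒≤ : ∀ x → Worst Γ π X x → ∀ y → y ≥⟨ o ⟩ x
    Worst⇒≤ _ (φ , γ@(φ∈Γ , _) , sX , rX) y =
      subst₂ (_≥⟨ o ⟩_) ([≔]-same (witnessˡ nonempty φ) X y) (witnessʳ-s nonempty φ wf X _ sX)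
        (pos⇒TiedPairsOrdered φ∈Γ _ _
          (InStar-[≔]ˡ {φ = φ} (defined⇒Unfixed {φ = φ} wf (inj₂ (_ , sX))) rX
            (witness-InStar nonempty φ wf))
          (Equiv-[≔]ˡ X∉π (GammaBar⇒witness-Equiv γ)))
      where
      wf : WellFormed φ
      wf = wf⁺ φ∈Γ

    Neg⇒≥ : ∀ {a b} → Neg Γ π X a b → a ≥⟨ o ⟩ b
    Neg⇒≥ {a} {b} (φ , φ∈Γ , covered , sX , rX) with π′⊨*Γ (neg φ) φ∈Γ
    ... | σ , _ , ¬sat = ≯⇒≥ o λ b>a → ¬sat (Equivalence.from (SatKind⁻⇔ φ∈Γ) λ α β st →
      inj₁ (subst (λ ρ → Strict ρ α β) (sym (∷ʳ-++ π (X , o) σ))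
              (Strict-next π (covered⇒Equiv {φ = φ} covered st) (reversed st b>a))))
      where
      reversed : ∀ {α β} → InStar φ α β → b >⟨ o ⟩ a → α X >⟨ o ⟩ β X
      reversed (_ , αr , _ , βs , _) = subst₂ (_>⟨ o ⟩_) (sym (αr X b rX)) (sym (βs X a sX))

    Pairs⇒≥ : ∀ a b → Pairs Γ π X a b → a ≥⟨ o ⟩ b
    Pairs⇒≥ _ _ = [ Pos⇒≥ , Neg⇒≥ ]′

    valid : ValidExtension Γ π X o
    valid = ( X∉π
            , GammaBar⇒∉W
            , R⁺-irrefl o Pairs-irrefl (Pairs⇒≥ _ _)
            , (λ x y x-best y-best → top-unique o (Best⇒≥ x x-best) (Best⇒≥ y y-best))
            , (λ x y x-worst y-worst → bottom-unique o (Worst⇒≤ x x-worst) (Worst⇒≤ y y-worst))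
            , (λ x x-best → R-into-top o Pairs-irrefl (Pairs⇒≥ _ _) (Best⇒≥ x x-best))
            , (λ x x-worst → R-out-of-bottom o Pairs-irrefl (Pairs⇒≥ _ _) (Worst⇒≤ x x-worst)) )
          , Pairs⇒≥ , Best⇒≥ , Worst⇒≤

  reinserted : {ψ : Formula n d} (σ : LexSeq n d) → IsLex (π ++ σ) →
               (π ++ (X , o) ∷ without X σ) ⊨ ψ → (π ∷ʳ (X , o)) ⊨* ψ
  reinserted {ψ} σ lex sat =
    without X σ , subst IsLex (sym shape) (IsLex-reinsert π σ X∉π lex) , subst (_⊨ ψ) (sym shape) sat
    where
    shape : π ∷ʳ (X , o) ++ without X σ ≡ π ++ (X , o) ∷ without X σ
    shape = ∷ʳ-++ π (X , o) (without X σ)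

  module Sufficiency
    (∉W : ∀ φ → GammaBar Γ π X φ → ¬ X ∈W φ)
    (Pairs⇒≥ : ∀ a b → Pairs Γ π X a b → a ≥⟨ o ⟩ b)
    (Best⇒≥ : ∀ x → Best Γ π X x → ∀ y → x ≥⟨ o ⟩ y)
    (Worst⇒≤ : ∀ x → Worst Γ π X x → ∀ y → y ≥⟨ o ⟩ x)
    where

    GammaBar⇒≥ : {φ : Stmt n d} {α β : Outcome n d} →
                 GammaBar Γ π X φ → InStar φ α β → α X ≥⟨ o ⟩ β X
    GammaBar⇒≥ {φ} {α} {β} γ (αu , αr , βu , βs , αβT) with u φ X in uX
    ... | just x = ≥-reflexive o (trans (αu X x uX) (sym (βu X x uX)))
    ... | nothing with X ∈? T φ
    ...   | yes X∈T = ≥-reflexive o (αβT X X∈T)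
    ...   | no X∉T with r φ X in rX | s φ X in sX
    ...     | just a  | just b  = subst₂ (_≥⟨ o ⟩_) (sym (αr X a rX)) (sym (βs X b sX))
                                    (Pairs⇒≥ a b (inj₁ (φ , γ , rX , sX)))
    ...     | just a  | nothing = subst (_≥⟨ o ⟩ β X) (sym (αr X a rX))
                                    (Best⇒≥ a (φ , γ , rX , sX) (β X))
    ...     | nothing | just b  = subst (α X ≥⟨ o ⟩_) (sym (βs X b sX))
                                    (Worst⇒≤ b (φ , γ , sX , rX) (α X))
    ...     | nothing | nothing = ⊥-elim (∉W φ γ (rX , sX , X∉T , uX))

    pos-preserved : {φ : Stmt n d} → pos φ ∈ Γ → π ⊨* pos φ → (π ∷ʳ (X , o)) ⊨* pos φ
    pos-preserved {φ} φ∈Γ (σ , lex , sat) =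
      reinserted σ lex (SatKind-mono (kind φ) (λ st → Weak-promote π σ (ordered st))
                                              (λ st → Strict-promote π σ (ordered st)) sat)
      where
      ordered : ∀ {α β} → InStar φ α β → Equiv π α β → α X ≢ β X → α X >⟨ o ⟩ β X
      ordered st E α≢β = GammaBar⇒≥ (φ∈Γ , both-defined⇒∉ {φ = φ} (wf⁺ φ∈Γ) st E) st , α≢β

    -- A variable of π outside T ∪ U lies in R = S, where tied pairs cannot exist,
    -- or in W_φ, where φ can be refuted by changing the pair there.
    neg-covered : {σ : LexSeq n d} {φ : Stmt n d} {α β : Outcome n d} → neg φ ∈ Γ →
                  (∀ α β → InStar φ α β → Weak (π ++ σ) α β) → InStar φ α β → Equiv π α β →
                  ∀ Y → Y ∈ vars π → Y ∈ₛ T φ ⊎ IsJust (u φ Y)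
    neg-covered {σ} {φ} φ∈Γ weak st E Y Y∈π =
      decidable-stable (Y ∈? T φ ⊎-dec IsJust? (u φ Y)) uncovered-absurd
      where
      uncovered-absurd : ¬ ¬ (Y ∈ₛ T φ ⊎ IsJust (u φ Y))
      uncovered-absurd uncovered with u φ Y in uY | r φ Y in rY
      ... | just x  | _       = uncovered (inj₂ (x , refl))
      ... | nothing | just a  =
        both-defined⇒∉ {φ = φ} (wf⁻ φ∈Γ) st E Y (a , rY) (r⇒s⁻ φ∈Γ Y (a , rY)) Y∈π
      ... | nothing | nothing =
        let Y∉T = uncovered ∘ inj₁
            Y∈W = rY , IsJust-contrapositive (s⇒r⁻ φ∈Γ Y) rY , Y∉T , uY
            2≤dY = outside-T⇒nontrivial {φ = φ} (wf⁻ φ∈Γ) (nonempty Y) Y∉T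
            _ , _ , β′≻α′ = Strict-reversed-at π Y∈π 2≤dY E
        in Strict⇒¬Weak _ (Strict-++ π β′≻α′) (weak _ _ (InStar-[≔]-W {φ = φ} Y∈W st))

    neg-tied⇒≡ : {σ : LexSeq n d} {φ : Stmt n d} {α β : Outcome n d} → neg φ ∈ Γ →
                 (∀ α β → InStar φ α β → Weak (π ++ (X , o) ∷ σ) α β) →
                 InStar φ α β → Equiv π α β → α X ≡ β X
    neg-tied⇒≡ {σ} {φ} {α} {β} φ∈Γ weak st@(αu , αr , βu , βs , αβT) E with u φ X in uX
    ... | just x = trans (αu X x uX) (sym (βu X x uX))
    ... | nothing with X ∈? T φ
    ...   | yes X∈T = αβT X X∈T
    ...   | no X∉T with r φ X in rX
    ...     | nothing =
      ⊥-elim (TiedPairsOrdered⇒∉W {φ = φ} (wf⁻ φ∈Γ) (Weak-next⇒TiedPairsOrdered {φ = φ} weak) st E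
                (rX , IsJust-contrapositive (s⇒r⁻ φ∈Γ X) rX , X∉T , uX))
    ...     | just b  =
      let a , sX = r⇒s⁻ φ∈Γ X (b , rX)
          b≥a = subst₂ (_≥⟨ o ⟩_) (αr X b rX) (βs X a sX)
                  (Weak-next⇒TiedPairsOrdered {φ = φ} weak α β st E)
          a≥b = Pairs⇒≥ a b (inj₂ (φ , φ∈Γ , neg-covered φ∈Γ weak st E , sX , rX))
      in begin
        α X ≡⟨ αr X b rX ⟩
        b   ≡⟨ ≥-antisym o b≥a a≥b ⟩
        a   ≡⟨ βs X a sX ⟨
        β X ∎
      where open ≡-Reasoning

    neg-preserved : {φ : Stmt n d} → neg φ ∈ Γ → π ⊨* neg φ → (π ∷ʳ (X , o)) ⊨* neg φ
    neg-preserved {φ} φ∈Γ (σ , lex , ¬sat) = reinserted {ψ = neg φ} σ lex λ sat′ →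
      let weak = Equivalence.to (SatKind⁻⇔ φ∈Γ) sat′
      in ¬sat (Equivalence.from (SatKind⁻⇔ φ∈Γ) λ α β st →
                 Weak-demote π σ (neg-tied⇒≡ φ∈Γ weak st) (weak α β st))

    preserved : π ⊨*Γ Γ → (π ∷ʳ (X , o)) ⊨*Γ Γ
    preserved π⊨*Γ (pos φ) φ∈Γ = pos-preserved φ∈Γ (π⊨*Γ _ φ∈Γ)
    preserved π⊨*Γ (neg φ) φ∈Γ = neg-preserved φ∈Γ (π⊨*Γ _ φ∈Γ)

proposition14 : {n : ℕ} {d : Fin n → ℕ} → (∀ i → 1 ≤ d i) →
    (Γ : List (Formula n d)) → InL' Γ →
    (π : LexSeq n d) → IsLex π → π ⊨*Γ Γ →
    (X : Fin n) → X ∉ vars π → (o : TotalOrd (d X)) →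
    ((π ∷ʳ (X , o)) ⊨*Γ Γ) ⇔ ValidExtension Γ π X o
proposition14 nonempty Γ Γ∈L′ π _ π⊨*Γ X X∉π o =
  mk⇔ Necessity.valid λ ((_ , ∉W , _) , Pairs⇒≥ , Best⇒≥ , Worst⇒≤) →
    Sufficiency.preserved ∉W Pairs⇒≥ Best⇒≥ Worst⇒≤ π⊨*Γ
  where open Extension nonempty Γ Γ∈L′ π X X∉π o
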